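{- There exist constants $c_0 \geq c_1 > 0$ such that for all sufficiently large $N$, the smallest integer $M$ (with $0\le M\le \binom{N}{2}$) for which there is no forest $F$ with exactly $N$ edges whose line graph $L(F)$ has exactly $M$ edges satisfies \[\frac{N^2}{2}-c_0N\sqrt{N} \;\leq\; M \;\leq\; \frac{N^2}{2}-c_1N\sqrt{N}.\]
   Context: All graphs are finite and simple; a forest is an acyclic graph. For a graph $G$, the line graph $L(G)$ has the edges of $G$ as vertices, adjacent when they share an endpoint, so $e(L(G))=\sum_v\binom{\deg(v)}{2}$. -}

module Defs where

open import Data.Nat using (ℕ; _<_; _≤_; _^_; _∸_)
open import Data.Nat.Combinatorics using (_C_)
open import Data.Fin using (Fin; toℕ; _≟_)
open import Data.Product using (Σ; _×_; proj₁; proj₂; _,_)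
open import Data.Sum using (_⊎_)
open import Data.List using (List; []; _∷_; length; filter; map; _∷ʳ_)
open import Data.Nat.ListAction using (sum)
open import Data.List.Membership.Propositional using (_∈_)
open import Data.List.Relation.Unary.All using (All)
open import Data.List.Relation.Unary.Unique.Propositional using (Unique)
open import Data.List.Relation.Unary.Linked using (Linked)
open import Data.Fin.Base using () renaming (_<_ to _<ᶠ_)
open import Data.Integer using (+_)
open import Data.Rational using (ℚ; _/_; _*_; _-_) renaming (_≤_ to _≤ℚ_)
open import Data.List using (allFin) public
open import Relation.Binary.PropositionalEquality using (_≡_)
open import Relation.Nullary using (¬_)
open import Relation.Nullary.Decidable using (_⊎-dec_)

record Graph : Set where
  field
    n      : ℕ
    edges  : List (Fin n × Fin n)
    ordered : All (λ e → proj₁ e <ᶠ proj₂ e) edges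
    noDup  : Unique edges
open Graph public

Adj : (G : Graph) → Fin (n G) → Fin (n G) → Set
Adj G u v = ((u , v) ∈ edges G) ⊎ ((v , u) ∈ edges G)

-- a cycle: distinct vertices v0 , w1 , ... , wk (k ≥ 2, so ≥ 3 vertices)
-- with v0 ~ w1 ~ ... ~ wk ~ v0
HasCycle : Graph → Set
HasCycle G = Σ (Fin (n G)) λ v0 → Σ (List (Fin (n G))) λ ws →
  (2 ≤ length ws) × Unique (v0 ∷ ws) × Linked (Adj G) ((v0 ∷ ws) ∷ʳ v0)

IsForest : Graph → Set
IsForest G = ¬ HasCycle G

e : Graph → ℕ
e G = length (edges G)

deg : (G : Graph) → Fin (n G) → ℕ
deg G v = length (filter (λ x → (proj₁ x ≟ v) ⊎-dec (proj₂ x ≟ v)) (edges G))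

-- number of edges of the line graph: e(L(G)) = Σ_v C(deg v, 2)
eL : Graph → ℕ
eL G = sum (map (λ v → deg G v C 2) (allFin (n G)))

Realizable : ℕ → ℕ → Set
Realizable N M = Σ Graph λ F → IsForest F × (e F ≡ N) × (eL F ≡ M)

SmallestMissing : ℕ → ℕ → Set
SmallestMissing N M = (M ≤ N C 2) × ¬ Realizable N M × (∀ m → m < M → Realizable N m)

toℚ : ℕ → ℚ
toℚ k = (+ k) / 1

-- Comparisons with c·N·√N (for c ≥ 0), stated without square roots:
--   x ≤ c N √N   ⇔  x ≤ 0  ∨  x² ≤ c² N³
--   c N √N ≤ x   ⇔  0 ≤ x  ∧  c² N³ ≤ x²
≤cN√N : ℚ → ℚ → ℕ → Set
≤cN√N x c N = (x ≤ℚ toℚ 0) ⊎ (x * x ≤ℚ c * c * toℚ (N ^ 3))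

cN√N≤ : ℚ → ℕ → ℚ → Set
cN√N≤ c N x = (toℚ 0 ≤ℚ x) × (c * c * toℚ (N ^ 3) ≤ℚ x * x)

gap : ℕ → ℕ → ℚ
gap N M = ((+ (N ^ 2)) / 2) - toℚ M

{-# OPTIONS --safe #-}
-- For a forest with degrees d_v we have e(L(F)) = Σ C(d_v, 2) = Σ T(d_v − 1), with T the triangular
-- numbers, and Σ (d_v − 1) ≤ N − 1 (delete a leaf edge and induct).  Conversely, a caterpillar whose
-- spine vertices have degrees a_i + 1, together with isolated edges, is a forest with N edges realising
-- Σ T(a_i) whenever Σ a_i ≤ N − 1.  So M is the least number that is not such a sum of triangular numbers.
-- Write N = s² + r with r ≤ 2s.  Two greedy triangular numbers followed by ones represent every
-- m ≤ T(A) + A for A = N − 1 − 4s, while by convexity of T the value T(L) + L with L = N − 1 − s is not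
-- representable.  Hence T(A) + A < M ≤ T(L) + L, that is sN ≤ N² − 2M ≤ 8sN, and s is about √N.
module Submission where

open import Defs
open import Data.Nat using (ℕ; _≤_)
open import Data.Product using (Σ; _×_)
open import Data.Rational using (ℚ; 0ℚ) renaming (_<_ to _<ℚ_; _≤_ to _≤ℚ_)

open import Data.Bool using (true; false)
open import Data.Empty using (⊥; ⊥-elim)
open import Data.Fin using (Fin; zero; suc; _≟_) renaming (_<_ to _<ᶠ_; _>_ to _>ᶠ_)
import Data.Fin.Properties as Fin
open import Data.Integer using (+≤+; +<+) renaming (+_ to pos; _+_ to _+ℤ_; _*_ to _*ℤ_; -_ to -ℤ_)
import Data.Integer.Properties as ℤ
import Data.Integer.Tactic.RingSolver as ℤ-Solver
open import Data.List using (List; []; _∷_; _++_; _∷ʳ_; length; filter; map; tabulate; lookup; initLast; _∷ʳ′_)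
open import Data.List.Properties
  using (length-++; length-map; ++-assoc; map-∘; map-cong; map-tabulate; tabulate-cong; length-filter; filter-accept; filter-reject)
open import Data.List.Membership.Propositional using (_∈_; _∉_)
open import Data.List.Membership.Propositional.Properties using (∈-filter⁺; ∈-filter⁻; ∈-∃++; ∈-lookup; ∈-map⁺; ∈-++⁺ˡ; ∈-++⁺ʳ)
import Data.List.Membership.DecPropositional as DecMembership
open import Data.List.Relation.Binary.Permutation.Propositional using (_↭_; ↭-sym; ↭⇒↭ₛ)
open import Data.List.Relation.Binary.Permutation.Propositional.Properties
  using (All-resp-↭; ∈-resp-↭; ↭-length; filter-↭; shift; ∷↭∷ʳ)
import Data.List.Relation.Binary.Permutation.Setoid.Properties as PermutationSetoid
open import Data.List.Relation.Unary.All as All using (All; []; _∷_)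
open import Data.List.Relation.Unary.All.Properties using (++⁻ˡ; ¬All⇒Any¬) renaming (map⁺ to All-map⁺)
open import Data.List.Relation.Unary.AllPairs as AllPairs using ([]; _∷_)
open import Data.List.Relation.Unary.Any as Any using (Any; here; there)
open import Data.List.Relation.Unary.Linked as Linked using (Linked; []; [-]; _∷_)
open import Data.List.Relation.Unary.Linked.Properties using (Linked⇒AllPairs)
open import Data.List.Relation.Unary.Unique.Propositional using (Unique)
import Data.List.Relation.Unary.Unique.Propositional.Properties as Unique
open import Data.Nat using (zero; suc; _+_; _*_; _∸_; _^_; _<_; _⊓_; z≤n; s≤s; _≤?_)
open import Data.Nat.Combinatorics using (_C_; nC1≡n; nCk+nC[k+1]≡[n+1]C[k+1])
open import Data.Nat.ListAction using (sum)
open import Data.Nat.Properties hiding (_≟_)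
open import Algebra.Properties.CommutativeSemigroup +-commutativeSemigroup using (xy∙z≈xz∙y; x∙yz≈y∙xz)
open import Data.Nat.Tactic.RingSolver using (solve-∀)
open import Data.Product using (∃; ∃₂; proj₁; proj₂; _,_)
open import Data.Product.Properties using (≡-dec)
import Data.Rational as ℚ
import Data.Rational.Properties as ℚ
import Data.Rational.Unnormalised as ℚᵘ
import Data.Rational.Unnormalised.Properties as ℚᵘ
open import Data.Sum using (_⊎_; inj₁; inj₂; swap; [_,_]) renaming (map to ⊎-map)
open import Function using (_∘_; id)
open import Relation.Binary using (tri<; tri≈; tri>)
open import Relation.Binary.PropositionalEquality hiding ([_])
open import Relation.Nullary using (¬_; Dec; yes; no; does)
open import Relation.Nullary.Decidable using (_⊎-dec_; _×-dec_; ¬?; map′)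

Unique-++⁻ˡ : ∀ {A : Set} (xs : List A) {ys} → Unique (xs ++ ys) → Unique xs
Unique-++⁻ˡ []       _          = []
Unique-++⁻ˡ (x ∷ xs) (x∉ ∷ uniq) = ++⁻ˡ xs x∉ ∷ Unique-++⁻ˡ xs uniq

Linked-++⁻ˡ : ∀ {A : Set} {R : A → A → Set} (xs : List A) {ys} → Linked R (xs ++ ys) → Linked R xs
Linked-++⁻ˡ []           _          = []
Linked-++⁻ˡ (x ∷ [])     _          = [-]
Linked-++⁻ˡ (x ∷ y ∷ xs) (r ∷ rs)   = r ∷ Linked-++⁻ˡ (y ∷ xs) rs

Linked-∷ʳ : ∀ {A : Set} {R : A → A → Set} (xs : List A) {y z} → Linked R (xs ∷ʳ y) → R y z → Linked R (xs ∷ʳ y ∷ʳ z)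
Linked-∷ʳ []           _         r = r ∷ [-]
Linked-∷ʳ (x ∷ [])     (r′ ∷ _)  r = r′ ∷ r ∷ [-]
Linked-∷ʳ (x ∷ w ∷ xs) (r′ ∷ rs) r = r′ ∷ Linked-∷ʳ (w ∷ xs) rs r

Unique-All≡-length : ∀ {A : Set} {c : A} {xs} → Unique xs → All (_≡ c) xs → c ∈ xs → length xs ≡ 1
Unique-All≡-length {xs = _ ∷ []}    _                  _              _ = refl
Unique-All≡-length {xs = _ ∷ _ ∷ _} ((x≢y ∷ _) ∷ _) (x≡c ∷ y≡c ∷ _) _ = ⊥-elim (x≢y (trans x≡c (sym y≡c)))

Unique-lookup-< : ∀ {A : Set} {xs : List A} → Unique xs → ∀ {i j} → i <ᶠ j → lookup xs i ≢ lookup xs j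
Unique-lookup-< (x∉ ∷ _)    {zero}  {suc j} _         = All.lookup x∉ (∈-lookup j)
Unique-lookup-< (_ ∷ uniq) {suc i} {suc j} (s≤s i<j) = Unique-lookup-< uniq i<j

Unique-length≤ : ∀ {n} (xs : List (Fin n)) → Unique xs → length xs ≤ n
Unique-length≤ {n} xs uniq with n <? length xs
... | no  n≮len = ≮⇒≥ n≮len
... | yes n<len with Fin.pigeonhole n<len (lookup xs)
...   | i , j , i<j , eq = ⊥-elim (Unique-lookup-< uniq i<j eq)

∈⇒↭ : ∀ {A : Set} {x : A} {xs} → x ∈ xs → ∃ λ rest → xs ↭ x ∷ rest
∈⇒↭ x∈ with pre , post , refl ← ∈-∃++ x∈ = pre ++ post , shift _ pre post

Unique-resp-↭ : ∀ {A : Set} {xs ys : List A} → xs ↭ ys → Unique xs → Unique ys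
Unique-resp-↭ p = PermutationSetoid.Unique-resp-↭ (setoid _) (↭⇒↭ₛ p)

length≡suc⇒∈ : ∀ {A : Set} {xs : List A} {k} → length xs ≡ suc k → ∃ (_∈ xs)
length≡suc⇒∈ {xs = x ∷ _} _ = x , here refl

data EndsWith {A : Set} (R : A → A → Set) : List A → Set where
  here  : ∀ {x y} → R x y → EndsWith R (x ∷ y ∷ [])
  there : ∀ {x xs} → EndsWith R xs → EndsWith R (x ∷ xs)

EndsWith-∷ʳ : ∀ {A : Set} {R : A → A → Set} (xs : List A) {a b} → R a b → EndsWith R (xs ∷ʳ a ∷ʳ b)
EndsWith-∷ʳ []       r = here r
EndsWith-∷ʳ (x ∷ xs) r = there (EndsWith-∷ʳ xs r)

Linked-last : ∀ {A : Set} {R : A → A → Set} (xs : List A) {a b} → Linked R (xs ∷ʳ a ∷ʳ b) → R a b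
Linked-last []           (r ∷ _) = r
Linked-last (x ∷ [])     (_ ∷ l) = Linked-last [] l
Linked-last (x ∷ y ∷ xs) (_ ∷ l) = Linked-last (y ∷ xs) l

Unique-map⇒injective : ∀ {A B : Set} (f : A → B) {xs x y} → Unique (map f xs) → x ∈ xs → y ∈ xs → f x ≡ f y → x ≡ y
Unique-map⇒injective f _          (here refl) (here refl) _  = refl
Unique-map⇒injective f (fx∉ ∷ _)  (here refl) (there y∈)  eq = ⊥-elim (All.lookup fx∉ (∈-map⁺ f y∈) eq)
Unique-map⇒injective f (fy∉ ∷ _)  (there x∈)  (here refl) eq = ⊥-elim (All.lookup fy∉ (∈-map⁺ f x∈) (sym eq))
Unique-map⇒injective f (_ ∷ uniq) (there x∈)  (there y∈)  eq = Unique-map⇒injective f uniq x∈ y∈ eq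

>ᶠ-trans : ∀ {n} {a b c : Fin n} → a >ᶠ b → b >ᶠ c → a >ᶠ c
>ᶠ-trans a>b b>c = Fin.<-trans b>c a>b

sum-map-allFin : ∀ {n} (f : Fin n → ℕ) → sum (map f (allFin n)) ≡ sum (tabulate f)
sum-map-allFin f = cong sum (map-tabulate id f)

sum-tabulate-zero : ∀ {n} {f : Fin n → ℕ} → (∀ w → f w ≡ 0) → sum (tabulate f) ≡ 0
sum-tabulate-zero {zero}  _   = refl
sum-tabulate-zero {suc n} f≡0 = cong₂ _+_ (f≡0 zero) (sum-tabulate-zero (f≡0 ∘ suc))

sum-tabulate-mono : ∀ {n} {f g : Fin n → ℕ} → (∀ w → f w ≤ g w) → sum (tabulate f) ≤ sum (tabulate g)
sum-tabulate-mono {zero}  _   = z≤n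
sum-tabulate-mono {suc n} f≤g = +-mono-≤ (f≤g zero) (sum-tabulate-mono (f≤g ∘ suc))

sum-tabulate-≤-except : ∀ {n} {f g : Fin n → ℕ} (v : Fin n) {k} →
  (∀ w → w ≢ v → f w ≤ g w) → f v ≤ g v + k → sum (tabulate f) ≤ sum (tabulate g) + k
sum-tabulate-≤-except {g = g} zero {k} f≤g fv≤ = begin
  _                                  ≤⟨ +-mono-≤ fv≤ (sum-tabulate-mono (λ w → f≤g (suc w) λ ())) ⟩
  g zero + k + sum (tabulate (g ∘ suc)) ≡⟨ xy∙z≈xz∙y (g zero) k _ ⟩
  _                                  ∎
  where open ≤-Reasoning
sum-tabulate-≤-except {g = g} (suc v) {k} f≤g fv≤ = begin
  _                                  ≤⟨ +-mono-≤ (f≤g zero λ ())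
                                          (sum-tabulate-≤-except v (λ w w≢v → f≤g (suc w) (w≢v ∘ Fin.suc-injective)) fv≤) ⟩
  g zero + (sum (tabulate (g ∘ suc)) + k) ≡⟨ +-assoc (g zero) _ k ⟨
  _                                  ∎
  where open ≤-Reasoning

sum-tabulate-≡-except : ∀ {n} {f g : Fin n → ℕ} (v : Fin n) {k} →
  (∀ w → w ≢ v → f w ≡ g w) → f v ≡ g v + k → sum (tabulate f) ≡ sum (tabulate g) + k
sum-tabulate-≡-except {f = f} {g} zero {k} f≡g fv≡ = begin
  f zero + sum (tabulate (f ∘ suc)) ≡⟨ cong₂ _+_ fv≡ (cong sum (tabulate-cong λ w → f≡g (suc w) λ ())) ⟩
  g zero + k + sum (tabulate (g ∘ suc)) ≡⟨ xy∙z≈xz∙y (g zero) k _ ⟩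
  _                                  ∎
  where open ≡-Reasoning
sum-tabulate-≡-except {f = f} {g} (suc v) {k} f≡g fv≡ = begin
  f zero + sum (tabulate (f ∘ suc)) ≡⟨ cong₂ _+_ (f≡g zero λ ())
                                          (sum-tabulate-≡-except v (λ w w≢v → f≡g (suc w) (w≢v ∘ Fin.suc-injective)) fv≡) ⟩
  g zero + (sum (tabulate (g ∘ suc)) + k) ≡⟨ +-assoc (g zero) _ k ⟨
  _                                  ∎
  where open ≡-Reasoning

-- Leaves and the degree excess of forests

Edge : ℕ → Set
Edge n = Fin n × Fin n

Incident : ∀ {n} → Fin n → Edge n → Set
Incident v x = proj₁ x ≡ v ⊎ proj₂ x ≡ v

incident? : ∀ {n} (v : Fin n) (x : Edge n) → Dec (Incident v x)
incident? v x = (proj₁ x ≟ v) ⊎-dec (proj₂ x ≟ v)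

HasLeaf : Graph → Set
HasLeaf G = ∃₂ λ u v → Adj G u v × deg G u ≡ 1

module _ {G : Graph} where

  edge-ordered : ∀ {x} → x ∈ edges G → proj₁ x <ᶠ proj₂ x
  edge-ordered = All.lookup (ordered G)

  reversed-edge-∉ : ∀ {a b} → (a , b) ∈ edges G → (b , a) ∉ edges G
  reversed-edge-∉ ab ba = Fin.<-asym (edge-ordered ab) (edge-ordered ba)

  adj⇒≢ : ∀ {u v} → Adj G u v → u ≢ v
  adj⇒≢ (inj₁ uv) refl = Fin.<-irrefl refl (edge-ordered uv)
  adj⇒≢ (inj₂ vu) refl = Fin.<-irrefl refl (edge-ordered vu)

  adj? : ∀ u v → Dec (Adj G u v)
  adj? u v = ((u , v) ∈? edges G) ⊎-dec ((v , u) ∈? edges G)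
    where open DecMembership (≡-dec _≟_ _≟_)

  deg≡1 : ∀ {z y} → Adj G z y → (∀ {w} → Adj G z w → w ≡ y) → deg G z ≡ 1
  deg≡1 {z} {y} (inj₁ zy) only-y =
    Unique-All≡-length (Unique.filter⁺ (incident? z) (noDup G))
      (All.tabulate (λ x∈ → sole (∈-filter⁻ (incident? z) x∈))) (∈-filter⁺ (incident? z) zy (inj₁ refl))
    where
    sole : ∀ {x} → x ∈ edges G × Incident z x → x ≡ (z , y)
    sole (x∈ , inj₁ refl) with refl ← only-y (inj₁ x∈) = refl
    sole (x∈ , inj₂ refl) with refl ← only-y (inj₂ x∈) = ⊥-elim (reversed-edge-∉ zy x∈)
  deg≡1 {z} {y} (inj₂ yz) only-y =
    Unique-All≡-length (Unique.filter⁺ (incident? z) (noDup G))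
      (All.tabulate (λ x∈ → sole (∈-filter⁻ (incident? z) x∈))) (∈-filter⁺ (incident? z) yz (inj₂ refl))
    where
    sole : ∀ {x} → x ∈ edges G × Incident z x → x ≡ (y , z)
    sole (x∈ , inj₁ refl) with refl ← only-y (inj₁ x∈) = ⊥-elim (reversed-edge-∉ yz x∈)
    sole (x∈ , inj₂ refl) with refl ← only-y (inj₂ x∈) = refl

  closing-edge⇒cycle : ∀ {z y w rest} → Unique (z ∷ y ∷ rest) → Linked (Adj G) (z ∷ y ∷ rest) →
                       w ∈ rest → Adj G w z → HasCycle G
  closing-edge⇒cycle {z} {y} {w} uniq walk w∈rest wz with pre , post , refl ← ∈-∃++ w∈rest =
    z , y ∷ pre ∷ʳ w ,
    s≤s (subst (1 ≤_) (sym (length-++ pre)) (m≤n+m 1 (length pre))) ,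
    Unique-++⁻ˡ (z ∷ y ∷ pre ∷ʳ w) (subst Unique split uniq) ,
    Linked-∷ʳ (z ∷ y ∷ pre) (Linked-++⁻ˡ (z ∷ y ∷ pre ∷ʳ w) (subst (Linked (Adj G)) split walk)) wz
    where
    split : z ∷ y ∷ pre ++ w ∷ post ≡ (z ∷ y ∷ pre ∷ʳ w) ++ post
    split = cong (λ l → z ∷ y ∷ l) (sym (++-assoc pre (w ∷ []) post))

  open DecMembership (_≟_ {n G}) using () renaming (_∈?_ to _∈ᵥ?_)

  -- Grow the path at z while z has a neighbour off the path.  A neighbour on the path closes a cycle,
  -- so the end z of a maximal path is a leaf; a path has at most n G vertices, which bounds the fuel.
  maximal-path-leaf : IsForest G → ∀ fuel z y rest → Unique (z ∷ y ∷ rest) → Linked (Adj G) (z ∷ y ∷ rest) →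
                      n G ≤ fuel + length rest → HasLeaf G
  maximal-path-leaf forest fuel z y rest uniq walk bound
    with Fin.any? (λ w → adj? z w ×-dec ¬? (w ∈ᵥ? (z ∷ y ∷ rest)))
  ... | yes (w , zw , w∉) = extend fuel bound
    where
    uniq′ : Unique (w ∷ z ∷ y ∷ rest)
    uniq′ = All.tabulate (λ { w′∈ refl → w∉ w′∈ }) ∷ uniq
    extend : ∀ fuel → n G ≤ fuel + length rest → HasLeaf G
    extend zero     bound = ⊥-elim (≤⇒≯ bound (≤-trans (m≤n+m (suc (length rest)) 2) (Unique-length≤ _ uniq′)))
    extend (suc f)  bound = maximal-path-leaf forest f w z (y ∷ rest) uniq′ (swap zw ∷ walk)
                              (subst (n G ≤_) (sym (+-suc f (length rest))) bound)
  ... | no no-new-neighbour with Fin.any? (λ w → adj? z w ×-dec (w ∈ᵥ? rest))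
  ...   | yes (w , zw , w∈) = ⊥-elim (forest (closing-edge⇒cycle uniq walk w∈ (swap zw)))
  ...   | no no-back-edge = z , y , Linked.head walk , deg≡1 (Linked.head walk) only-y
    where
    only-y : ∀ {w} → Adj G z w → w ≡ y
    only-y {w} zw with w ∈ᵥ? (z ∷ y ∷ rest)
    ... | no w∉                   = ⊥-elim (no-new-neighbour (w , zw , w∉))
    ... | yes (here refl)         = ⊥-elim (adj⇒≢ zw refl)
    ... | yes (there (here refl)) = refl
    ... | yes (there (there w∈))  = ⊥-elim (no-back-edge (w , zw , w∈))

  forest-leaf : IsForest G → ∀ {x} → x ∈ edges G → HasLeaf G
  forest-leaf forest {a , b} ab =
    maximal-path-leaf forest (n G) b a [] (((λ { refl → Fin.<-irrefl refl (edge-ordered ab) }) ∷ []) ∷ [] ∷ [])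
      (inj₂ ab ∷ [-]) (m≤m+n (n G) 0)

Joins : ∀ {n} → Edge n → Fin n → Fin n → Set
Joins x u v = x ≡ (u , v) ⊎ x ≡ (v , u)

joins⇒incidentʳ : ∀ {n} {x : Edge n} {u v} → Joins x u v → Incident v x
joins⇒incidentʳ (inj₁ refl) = inj₂ refl
joins⇒incidentʳ (inj₂ refl) = inj₁ refl

incident-joins : ∀ {n} {x : Edge n} {u v w} → Joins x u v → Incident w x → w ≡ u ⊎ w ≡ v
incident-joins (inj₁ refl) (inj₁ refl) = inj₁ refl
incident-joins (inj₁ refl) (inj₂ refl) = inj₂ refl
incident-joins (inj₂ refl) (inj₁ refl) = inj₂ refl
incident-joins (inj₂ refl) (inj₂ refl) = inj₁ refl

adj⇒edge : ∀ {G : Graph} {u v} → Adj G u v → ∃ λ x → x ∈ edges G × Joins x u v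
adj⇒edge (inj₁ uv) = _ , uv , inj₁ refl
adj⇒edge (inj₂ vu) = _ , vu , inj₂ refl

module _ (G : Graph) {x : Edge (n G)} {rest : List (Edge (n G))} (p : edges G ↭ x ∷ rest) where

  deleteEdge : Graph
  deleteEdge = record
    { n       = n G
    ; edges   = rest
    ; ordered = All.tail (All-resp-↭ p (ordered G))
    ; noDup   = AllPairs.tail (Unique-resp-↭ p (noDup G))
    }

  deleteEdge-forest : IsForest G → IsForest deleteEdge
  deleteEdge-forest forest (v , ws , len , uniq , walk) =
    forest (v , ws , len , uniq , Linked.map (⊎-map keep keep) walk)
    where
    keep : ∀ {y} → y ∈ rest → y ∈ edges G
    keep y∈ = ∈-resp-↭ (↭-sym p) (there y∈)

  e-deleteEdge : e G ≡ suc (e deleteEdge)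
  e-deleteEdge = ↭-length p

  deg-deleteEdge-incident : ∀ {v} → Incident v x → deg G v ≡ suc (deg deleteEdge v)
  deg-deleteEdge-incident {v} inc = trans (↭-length (filter-↭ (incident? v) p)) (cong length (filter-accept (incident? v) inc))

  deg-deleteEdge-other : ∀ {v} → ¬ Incident v x → deg G v ≡ deg deleteEdge v
  deg-deleteEdge-other {v} ¬inc = trans (↭-length (filter-↭ (incident? v) p)) (cong length (filter-reject (incident? v) ¬inc))

-- Isolated vertices contribute 0 to the excess because subtraction is truncated.
excess : Graph → ℕ
excess G = sum (map (λ v → deg G v ∸ 1) (allFin (n G)))

deg≤e : ∀ G v → deg G v ≤ e G
deg≤e G v = length-filter (incident? v) (edges G)

module _ {G : Graph} {x : Edge (n G)} {rest} (p : edges G ↭ x ∷ rest) {u v} (joins : Joins x u v) (leaf : deg G u ≡ 1) where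

  deleteLeaf-excess : ∀ w → w ≢ v → deg G w ∸ 1 ≤ deg (deleteEdge G p) w ∸ 1
  deleteLeaf-excess w w≢v with w ≟ u
  ... | yes refl = ≤-trans (≤-reflexive (cong (_∸ 1) leaf)) z≤n
  ... | no  w≢u  = ≤-reflexive (cong (_∸ 1) (deg-deleteEdge-other G p λ inc → [ w≢u , w≢v ] (incident-joins joins inc)))

  deleteLeaf-excess-neighbour : deg G v ∸ 1 ≡ deg (deleteEdge G p) v
  deleteLeaf-excess-neighbour = cong (_∸ 1) (deg-deleteEdge-incident G p (joins⇒incidentʳ joins))

  deleteLeaf-excess-sum : ∀ {k} → deg (deleteEdge G p) v ≤ (deg (deleteEdge G p) v ∸ 1) + k →
                          excess G ≤ excess (deleteEdge G p) + k
  deleteLeaf-excess-sum {k} bump = begin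
    excess G                                                   ≡⟨ sum-map-allFin (λ w → deg G w ∸ 1) ⟩
    sum (tabulate λ w → deg G w ∸ 1)                           ≤⟨ sum-tabulate-≤-except v deleteLeaf-excess
                                                                    (≤-trans (≤-reflexive deleteLeaf-excess-neighbour) bump) ⟩
    sum (tabulate (λ w → deg (deleteEdge G p) w ∸ 1)) + k      ≡⟨ cong (_+ k) (sum-map-allFin (λ w → deg (deleteEdge G p) w ∸ 1)) ⟨
    excess (deleteEdge G p) + k                                ∎
    where open ≤-Reasoning

forest-excess≤ : ∀ k G → e G ≡ k → IsForest G → excess G ≤ e G ∸ 1
forest-excess≤ zero G e≡0 _ = ≤-trans (≤-reflexive excess≡0) z≤n
  where
  excess≡0 : excess G ≡ 0
  excess≡0 = trans (sum-map-allFin (λ v → deg G v ∸ 1)) (sum-tabulate-zero λ v →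
               cong (_∸ 1) (n≤0⇒n≡0 (subst (deg G v ≤_) e≡0 (deg≤e G v))))
forest-excess≤ (suc k) G e≡1+k forest
  with u , v , uv , leaf ← forest-leaf {G = G} forest (proj₂ (length≡suc⇒∈ e≡1+k))
  with x , x∈ , joins ← adj⇒edge {G = G} uv
  with rest , p ← ∈⇒↭ x∈
  = subst (excess G ≤_) (cong (_∸ 1) (sym (e-deleteEdge G p))) (bound (deg G′ v) refl)
  where
  G′ : Graph
  G′ = deleteEdge G p
  ih : excess G′ ≤ e G′ ∸ 1
  ih = forest-excess≤ k G′ (suc-injective (trans (sym (e-deleteEdge G p)) e≡1+k)) (deleteEdge-forest G p forest)
  -- Deleting the leaf edge lowers the excess only at the neighbour v, and there only if v keeps an edge.
  bound : ∀ d → deg G′ v ≡ d → excess G ≤ e G′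
  bound zero    d≡0 = begin
    excess G        ≤⟨ deleteLeaf-excess-sum {G = G} p joins leaf (≤-trans (≤-reflexive d≡0) z≤n) ⟩
    excess G′ + 0   ≤⟨ +-monoˡ-≤ 0 ih ⟩
    e G′ ∸ 1 + 0    ≤⟨ ≤-trans (≤-reflexive (+-identityʳ _)) (m∸n≤m (e G′) 1) ⟩
    e G′            ∎
    where open ≤-Reasoning
  bound (suc d) d≡1+d = begin
    excess G        ≤⟨ deleteLeaf-excess-sum {G = G} p joins leaf
                         (subst (λ t → t ≤ t ∸ 1 + 1) (sym d≡1+d) (≤-reflexive (+-comm 1 d))) ⟩
    excess G′ + 1   ≤⟨ +-monoˡ-≤ 1 ih ⟩
    e G′ ∸ 1 + 1    ≡⟨ m∸n+n≡m (≤-trans (s≤s z≤n) (subst (_≤ e G′) d≡1+d (deg≤e G′ v))) ⟩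
    e G′            ∎
    where open ≤-Reasoning

-- Forests built by attaching vertices

UniqueLowerEnds : Graph → Set
UniqueLowerEnds G = Unique (map proj₁ (edges G))

-- If every vertex is the smaller end of at most one edge, no vertex of a path lies below both of its
-- neighbours.  So a path that starts by descending keeps descending and one that ends by ascending
-- ascends throughout; on a cycle through v this leaves no possible direction for the two edges at v.
module _ {G : Graph} (lowerEnds : UniqueLowerEnds G) where

  adj-upward : ∀ {u v} → Adj G u v → u <ᶠ v → (u , v) ∈ edges G
  adj-upward (inj₁ uv) _   = uv
  adj-upward (inj₂ vu) u<v = ⊥-elim (Fin.<-asym u<v (edge-ordered {G = G} vu))

  no-valley : ∀ {a b c} → Adj G b a → Adj G b c → b <ᶠ a → b <ᶠ c → a ≡ c
  no-valley ba bc b<a b<c =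
    cong proj₂ (Unique-map⇒injective proj₁ lowerEnds (adj-upward ba b<a) (adj-upward bc b<c) refl)

  descending : ∀ {x y zs} → Unique (x ∷ y ∷ zs) → Linked (Adj G) (x ∷ y ∷ zs) → y <ᶠ x → Linked _>ᶠ_ (x ∷ y ∷ zs)
  descending {zs = []}    _                 _           y<x = y<x ∷ [-]
  descending {y = y} {z ∷ _} (x∉ ∷ uniq) (xy ∷ walk) y<x with Fin.<-cmp y z
  ... | tri< y<z _ _  = ⊥-elim (All.lookup x∉ (there (here refl)) (no-valley (swap xy) (Linked.head walk) y<x y<z))
  ... | tri≈ _ refl _ = ⊥-elim (adj⇒≢ {G = G} (Linked.head walk) refl)
  ... | tri> _ _ z<y  = y<x ∷ descending uniq walk z<y

  ascending : ∀ {xs} → Unique xs → Linked (Adj G) xs → EndsWith _<ᶠ_ xs → Linked _<ᶠ_ xs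
  ascending _ _ (here x<y) = x<y ∷ [-]
  ascending {xs = _ ∷ _ ∷ []} _ _ (there (there ()))
  ascending {xs = x ∷ y ∷ z ∷ _} (x∉ ∷ uniq) (xy ∷ walk) (there ends) with ascending uniq walk ends | Fin.<-cmp x y
  ... | asc | tri< x<y _ _  = x<y ∷ asc
  ... | _   | tri≈ _ refl _ = ⊥-elim (adj⇒≢ {G = G} xy refl)
  ... | asc | tri> _ _ y<x  =
    ⊥-elim (Fin.<-asym (Linked.head asc) (Linked.head (Linked.tail (descending (x∉ ∷ uniq) (xy ∷ walk) y<x))))

  module _ {v w us z} (uniq : Unique (v ∷ w ∷ us ∷ʳ z)) (walk : Linked (Adj G) (v ∷ w ∷ us ∷ʳ z ∷ʳ v)) where

    private
      down : w <ᶠ v → All (_<ᶠ v) (w ∷ us ∷ʳ z) × All (_<ᶠ w) (us ∷ʳ z)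
      down w<v with desc ← descending uniq (Linked-++⁻ˡ (v ∷ w ∷ us ∷ʳ z) walk) w<v =
        AllPairs.head (Linked⇒AllPairs >ᶠ-trans desc) , AllPairs.head (Linked⇒AllPairs >ᶠ-trans (Linked.tail desc))

      up : z <ᶠ v → All (w <ᶠ_) (us ∷ʳ z ∷ʳ v)
      up z<v = AllPairs.head (Linked⇒AllPairs Fin.<-trans
                 (ascending (Unique-resp-↭ (∷↭∷ʳ v (w ∷ us ∷ʳ z)) uniq) (Linked.tail walk) (EndsWith-∷ʳ (w ∷ us) z<v)))

      z∈ : z ∈ us ∷ʳ z
      z∈ = ∈-++⁺ʳ us (here refl)

      closing : Adj G z v
      closing = Linked-last (v ∷ w ∷ us) walk

    lowerEnds-no-cycle : ⊥
    lowerEnds-no-cycle with Fin.<-cmp z v | Fin.<-cmp w v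
    ... | tri< z<v _ _  | _             = Fin.<-asym (All.lookup (up z<v) (∈-++⁺ˡ z∈))
                                            (All.lookup (proj₂ (down (All.lookup (up z<v) (∈-++⁺ʳ (us ∷ʳ z) (here refl))))) z∈)
    ... | tri≈ _ refl _ | _             = adj⇒≢ {G = G} closing refl
    ... | tri> _ _ v<z  | tri< w<v _ _  = Fin.<-asym v<z (All.lookup (proj₁ (down w<v)) (there z∈))
    ... | tri> _ _ _    | tri≈ _ refl _ = adj⇒≢ {G = G} (Linked.head walk) refl
    ... | tri> _ _ v<z  | tri> _ _ v<w  =
      All.lookup (AllPairs.head (AllPairs.tail uniq)) z∈ (no-valley (Linked.head walk) (swap closing) v<w v<z)

  lowerEnds⇒forest : IsForest G
  lowerEnds⇒forest (v , ws , len , uniq , walk) with initLast ws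
  ... | []       ∷ʳ′ z = ≤⇒≯ len ≤-refl
  ... | (w ∷ us) ∷ʳ′ z = lowerEnds-no-cycle uniq walk

suc-C2 : ∀ d → suc d C 2 ≡ d C 2 + d
suc-C2 d = trans (sym (nCk+nC[k+1]≡[n+1]C[k+1] d 1)) (trans (cong (_+ d C 2) (nC1≡n d)) (+-comm d (d C 2)))

liftEdge : ∀ {n} → Edge n → Edge (suc n)
liftEdge (a , b) = suc a , suc b

liftEdge-injective : ∀ {n} {x y : Edge n} → liftEdge x ≡ liftEdge y → x ≡ y
liftEdge-injective {x = _ , _} {_ , _} refl = refl

-- `does (incident? (suc w) (liftEdge x))` computes to `does (incident? w x)`, so both filters branch alike.
count-liftEdge : ∀ {n} (E : List (Edge n)) w →
                 length (filter (incident? (suc w)) (map liftEdge E)) ≡ length (filter (incident? w) E)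
count-liftEdge []      w = refl
count-liftEdge (x ∷ E) w with does (incident? w x)
... | true  = cong suc (count-liftEdge E w)
... | false = count-liftEdge E w

count-liftEdge-zero : ∀ {n} (E : List (Edge n)) → length (filter (incident? zero) (map liftEdge E)) ≡ 0
count-liftEdge-zero []      = refl
count-liftEdge-zero (_ ∷ E) = count-liftEdge-zero E

lowerEnds-liftEdge : ∀ {n} (E : List (Edge n)) → map proj₁ (map liftEdge E) ≡ map suc (map proj₁ E)
lowerEnds-liftEdge E = trans (sym (map-∘ E)) (map-∘ E)

addVertex : Graph → Graph
addVertex G = record
  { n       = suc (n G)
  ; edges   = map liftEdge (edges G)
  ; ordered = All-map⁺ (All.map s≤s (ordered G))
  ; noDup   = Unique.map⁺ liftEdge-injective (noDup G)
  }

-- The new vertex is 0 and the old ones move up by one, so the new edge has a fresh smaller end.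
attach : (G : Graph) → Fin (n G) → Graph
attach G u = record
  { n       = suc (n G)
  ; edges   = (zero , suc u) ∷ map liftEdge (edges G)
  ; ordered = s≤s z≤n ∷ All-map⁺ (All.map s≤s (ordered G))
  ; noDup   = All-map⁺ (All.universal (λ _ ()) (edges G)) ∷ Unique.map⁺ liftEdge-injective (noDup G)
  }

module _ (G : Graph) where

  addVertex-lowerEnds : UniqueLowerEnds G → UniqueLowerEnds (addVertex G)
  addVertex-lowerEnds uniq = subst Unique (sym (lowerEnds-liftEdge (edges G))) (Unique.map⁺ Fin.suc-injective uniq)

  attach-lowerEnds : ∀ u → UniqueLowerEnds G → UniqueLowerEnds (attach G u)
  attach-lowerEnds u uniq = All-map⁺ (All-map⁺ (All.universal (λ _ ()) (edges G))) ∷ addVertex-lowerEnds uniq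

  e-addVertex : e (addVertex G) ≡ e G
  e-addVertex = length-map liftEdge (edges G)

  e-attach : ∀ u → e (attach G u) ≡ suc (e G)
  e-attach u = cong suc (length-map liftEdge (edges G))

  deg-addVertex-zero : deg (addVertex G) zero ≡ 0
  deg-addVertex-zero = count-liftEdge-zero (edges G)

  deg-addVertex-suc : ∀ w → deg (addVertex G) (suc w) ≡ deg G w
  deg-addVertex-suc = count-liftEdge (edges G)

  deg-attach-zero : ∀ u → deg (attach G u) zero ≡ 1
  deg-attach-zero u = cong suc (count-liftEdge-zero (edges G))

  deg-attach-self : ∀ u → deg (attach G u) (suc u) ≡ suc (deg G u)
  deg-attach-self u =
    trans (cong length (filter-accept (incident? (suc u)) {x = zero , suc u} {xs = map liftEdge (edges G)} (inj₂ refl)))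
          (cong suc (count-liftEdge (edges G) u))

  deg-attach-other : ∀ {u} w → w ≢ u → deg (attach G u) (suc w) ≡ deg G w
  deg-attach-other {u} w w≢u =
    trans (cong length (filter-reject (incident? (suc w)) {xs = map liftEdge (edges G)} ¬incident))
          (count-liftEdge (edges G) w)
    where
    ¬incident : ¬ Incident (suc w) (zero , suc u)
    ¬incident (inj₂ u≡w) = w≢u (sym (Fin.suc-injective u≡w))

  eL-addVertex : eL (addVertex G) ≡ eL G
  eL-addVertex = begin
    eL (addVertex G)                               ≡⟨ sum-map-allFin (λ v → deg (addVertex G) v C 2) ⟩
    deg (addVertex G) zero C 2 + sum (tabulate λ w → deg (addVertex G) (suc w) C 2)
                                                   ≡⟨ cong₂ (λ d s → d C 2 + s) deg-addVertex-zero
                                                        (cong sum (tabulate-cong λ w → cong (_C 2) (deg-addVertex-suc w))) ⟩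
    sum (tabulate λ w → deg G w C 2)               ≡⟨ sum-map-allFin (λ w → deg G w C 2) ⟨
    eL G                                           ∎
    where open ≡-Reasoning

  eL-attach : ∀ u → eL (attach G u) ≡ eL G + deg G u
  eL-attach u = begin
    eL (attach G u)                                ≡⟨ sum-map-allFin (λ v → deg (attach G u) v C 2) ⟩
    deg (attach G u) zero C 2 + sum (tabulate λ w → deg (attach G u) (suc w) C 2)
                                                   ≡⟨ cong (λ d → d C 2 + sum (tabulate λ w → deg (attach G u) (suc w) C 2))
                                                           (deg-attach-zero u) ⟩
    sum (tabulate λ w → deg (attach G u) (suc w) C 2)
                                                   ≡⟨ sum-tabulate-≡-except u (λ w w≢u → cong (_C 2) (deg-attach-other w w≢u))
                                                        (trans (cong (_C 2) (deg-attach-self u)) (suc-C2 (deg G u))) ⟩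
    sum (tabulate (λ w → deg G w C 2)) + deg G u   ≡⟨ cong (_+ deg G u) (sum-map-allFin (λ w → deg G w C 2)) ⟨
    eL G + deg G u                                 ∎
    where open ≡-Reasoning

-- Sums of triangular numbers

tri : ℕ → ℕ
tri zero    = 0
tri (suc k) = suc k + tri k

C2≡tri : ∀ d → d C 2 ≡ tri (d ∸ 1)
C2≡tri zero          = refl
C2≡tri (suc zero)    = refl
C2≡tri (suc (suc d)) = trans (suc-C2 (suc d)) (trans (+-comm _ (suc d)) (cong (suc d +_) (C2≡tri (suc d))))

2*tri : ∀ k → 2 * tri k ≡ k * suc k
2*tri zero    = refl
2*tri (suc k) = trans (*-distribˡ-+ 2 (suc k) (tri k)) (trans (cong (2 * suc k +_) (2*tri k)) (ring k))
  where
  ring : ∀ k → 2 * suc k + k * suc k ≡ suc k * suc (suc k)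
  ring = solve-∀

tri-split : ∀ y p q → tri (y + q) + tri (y + p) + p * q ≡ tri (y + p + q) + tri y
tri-split y p q = *-cancelˡ-≡ _ _ 2 (begin
  2 * (tri (y + q) + tri (y + p) + p * q)              ≡⟨ distrib₃ (tri (y + q)) (tri (y + p)) (p * q) ⟩
  2 * tri (y + q) + 2 * tri (y + p) + 2 * (p * q)      ≡⟨ cong₂ (λ a b → a + b + 2 * (p * q)) (2*tri (y + q)) (2*tri (y + p)) ⟩
  (y + q) * suc (y + q) + (y + p) * suc (y + p) + 2 * (p * q) ≡⟨ ring y p q ⟩
  (y + p + q) * suc (y + p + q) + y * suc y            ≡⟨ cong₂ _+_ (2*tri (y + p + q)) (2*tri y) ⟨
  2 * tri (y + p + q) + 2 * tri y                      ≡⟨ *-distribˡ-+ 2 (tri (y + p + q)) (tri y) ⟨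
  2 * (tri (y + p + q) + tri y)                        ∎)
  where
  open ≡-Reasoning
  distrib₃ : ∀ a b c → 2 * (a + b + c) ≡ 2 * a + 2 * b + 2 * c
  distrib₃ = solve-∀
  ring : ∀ y p q → (y + q) * suc (y + q) + (y + p) * suc (y + p) + 2 * (p * q) ≡ (y + p + q) * suc (y + p + q) + y * suc y
  ring = solve-∀

tri-superadditive : ∀ a b → tri a + tri b ≤ tri (a + b)
tri-superadditive a b = begin
  tri a + tri b          ≤⟨ m≤m+n _ (a * b) ⟩
  tri a + tri b + a * b  ≡⟨ cong (_+ a * b) (+-comm (tri a) (tri b)) ⟩
  tri b + tri a + a * b  ≡⟨ tri-split 0 a b ⟩
  tri (a + b) + 0        ≡⟨ +-identityʳ _ ⟩
  tri (a + b)            ∎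
  where open ≤-Reasoning

tri-mono : ∀ {a b} → a ≤ b → tri a ≤ tri b
tri-mono {a} {b} a≤b = begin
  tri a                  ≤⟨ m≤m+n (tri a) (tri (b ∸ a)) ⟩
  tri a + tri (b ∸ a)    ≤⟨ tri-superadditive a (b ∸ a) ⟩
  tri (a + (b ∸ a))      ≡⟨ cong tri (m+[n∸m]≡n a≤b) ⟩
  tri b                  ∎
  where open ≤-Reasoning

tri-bracket : ∀ t {r} → r ≤ tri t + t → ∃ λ b → b ≤ t × tri b ≤ r × r ≤ tri b + b
tri-bracket zero    r≤ = 0 , z≤n , z≤n , r≤
tri-bracket (suc t) {r} r≤ with r ≤? tri t + t
... | yes r≤′ with b , b≤t , lower , upper ← tri-bracket t r≤′ = b , m≤n⇒m≤1+n b≤t , lower , upper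
... | no  r≰  = suc t , ≤-refl , ≤-trans (≤-reflexive (cong suc (+-comm t (tri t)))) (≰⇒> r≰) , r≤

SumOfTriangles : ℕ → ℕ → Set
SumOfTriangles b m = Σ (List ℕ) λ as → sum as ≤ b × sum (map tri as) ≡ m

realizable⇒sumOfTriangles : ∀ {N m} → Realizable N m → SumOfTriangles (N ∸ 1) m
realizable⇒sumOfTriangles (G , forest , refl , refl) =
  map (λ v → deg G v ∸ 1) (allFin (n G)) ,
  forest-excess≤ (e G) G refl forest ,
  trans (cong sum (sym (map-∘ (allFin (n G))))) (cong sum (map-cong (λ v → sym (C2≡tri (deg G v))) (allFin (n G))))

-- The construction continues at the distinguished vertex of degree d.
Buildable : ℕ → ℕ → ℕ → Set
Buildable N M d = Σ Graph λ G → UniqueLowerEnds G × e G ≡ N × eL G ≡ M × ∃ λ x → deg G x ≡ d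

single-vertex : Buildable 0 0 0
single-vertex = record { n = 1 ; edges = [] ; ordered = [] ; noDup = [] } , [] , refl , refl , zero , refl

new-component : ∀ {N M d} → Buildable N M d → Buildable (suc N) M 1
new-component {M = M} (G , lowerEnds , refl , refl , _) =
  attach (addVertex G) zero ,
  attach-lowerEnds (addVertex G) zero (addVertex-lowerEnds G lowerEnds) ,
  trans (e-attach (addVertex G) zero) (cong suc (e-addVertex G)) ,
  trans (eL-attach (addVertex G) zero) (trans (cong₂ _+_ (eL-addVertex G) (deg-addVertex-zero G)) (+-identityʳ M)) ,
  zero , deg-attach-zero (addVertex G) zero

grow-leaf : ∀ {N M d} → Buildable N M d → Buildable (suc N) (M + d) (suc d)
grow-leaf (G , lowerEnds , refl , refl , x , refl) =
  attach G x , attach-lowerEnds G x lowerEnds , e-attach G x , eL-attach G x , suc x , deg-attach-self G x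

grow-path : ∀ {N M d} → Buildable N M d → Buildable (suc N) (M + d) 1
grow-path (G , lowerEnds , refl , refl , x , refl) =
  attach G x , attach-lowerEnds G x lowerEnds , e-attach G x , eL-attach G x , zero , deg-attach-zero G x

tri-step : ∀ k M → tri k + M + suc k ≡ tri (suc k) + M
tri-step k M = trans (+-comm (tri k + M) (suc k)) (sym (+-assoc (suc k) (tri k) M))

disjoint-edges : ∀ p → Buildable (suc p) 0 1
disjoint-edges zero    = new-component single-vertex
disjoint-edges (suc p) = new-component (disjoint-edges p)

grow-leaves : ∀ k {N M} → Buildable N M 1 → Buildable (k + N) (tri k + M) (suc k)
grow-leaves zero    b = b
grow-leaves (suc k) {N} {M} b = subst (λ M′ → Buildable (suc (k + N)) M′ (suc (suc k))) (tri-step k M) (grow-leaf (grow-leaves k b))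

grow-spine-vertex : ∀ a {N M} → Buildable N M 1 → Buildable (a + N) (tri a + M) 1
grow-spine-vertex zero    b = b
grow-spine-vertex (suc k) {N} {M} b = subst (λ M′ → Buildable (suc (k + N)) M′ 1) (tri-step k M) (grow-path (grow-leaves k b))

grow-caterpillar : ∀ as {N M} → Buildable N M 1 → Buildable (sum as + N) (sum (map tri as) + M) 1
grow-caterpillar []       b = b
grow-caterpillar (a ∷ as) {N} {M} b =
  subst₂ (λ N′ M′ → Buildable N′ M′ 1) (sym (+-assoc a (sum as) N)) (sym (+-assoc (tri a) (sum (map tri as)) M))
    (grow-spine-vertex a (grow-caterpillar as b))

sumOfTriangles⇒realizable : ∀ {N m} → 1 ≤ N → SumOfTriangles (N ∸ 1) m → Realizable N m
sumOfTriangles⇒realizable {suc N} _ (as , budget , refl)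
  with G , lowerEnds , e≡ , eL≡ , _ ← grow-caterpillar as (disjoint-edges (N ∸ sum as)) =
  G , lowerEnds⇒forest {G = G} lowerEnds ,
  trans e≡ (trans (+-suc (sum as) (N ∸ sum as)) (cong suc (m+[n∸m]≡n budget))) ,
  trans eL≡ (+-identityʳ _)

sumOfTriangles-ones : ∀ r → SumOfTriangles r r
sumOfTriangles-ones zero = [] , z≤n , refl
sumOfTriangles-ones (suc r) with as , budget , total ← sumOfTriangles-ones r = 1 ∷ as , s≤s budget , cong suc total

sumOfTriangles-∷ : ∀ a {b m} → SumOfTriangles b m → SumOfTriangles (a + b) (tri a + m)
sumOfTriangles-∷ a (as , budget , refl) = a ∷ as , +-monoʳ-≤ a budget , refl

sumOfTriangles-weaken : ∀ {b b′ m} → b ≤ b′ → SumOfTriangles b m → SumOfTriangles b′ m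
sumOfTriangles-weaken b≤b′ (as , budget , total) = as , ≤-trans budget b≤b′ , total

sumOfTriangles-upTo : ∀ A B {m} → A ≤ tri B + B → m ≤ tri A + A → SumOfTriangles (A + 2 * B) m
sumOfTriangles-upTo A B {m} A≤ m≤
  with a , a≤A , tri-a≤m , m≤′ ← tri-bracket A m≤
  with b , b≤B , tri-b≤r , r≤ ← tri-bracket B (≤-trans (m≤n+o⇒m∸n≤o m (tri a) m≤′) (≤-trans a≤A A≤)) =
  subst (SumOfTriangles (A + 2 * B)) total
    (sumOfTriangles-weaken budget (sumOfTriangles-∷ a (sumOfTriangles-∷ b (sumOfTriangles-ones (m ∸ tri a ∸ tri b)))))
  where
  r′≤B : m ∸ tri a ∸ tri b ≤ B
  r′≤B = ≤-trans (m≤n+o⇒m∸n≤o (m ∸ tri a) (tri b) r≤) b≤B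
  budget : a + (b + (m ∸ tri a ∸ tri b)) ≤ A + 2 * B
  budget = +-mono-≤ a≤A (≤-trans (+-mono-≤ b≤B r′≤B) (≤-reflexive (cong (B +_) (sym (+-identityʳ B)))))
  total : tri a + (tri b + (m ∸ tri a ∸ tri b)) ≡ m
  total = trans (cong (tri a +_) (m+[n∸m]≡n tri-b≤r)) (m+[n∸m]≡n tri-a≤m)

tri-exchange : ∀ {a x L} → a ≤ L → x ≤ L → L ≤ a + x → tri a + tri x ≤ tri L + tri (a + x ∸ L)
tri-exchange {a} {x} {L} a≤L x≤L L≤a+x = begin
  tri a + tri x                            ≤⟨ m≤m+n _ (p * q) ⟩
  tri a + tri x + p * q                    ≡⟨ cong₂ (λ a′ x′ → tri a′ + tri x′ + p * q) (sym y+q≡a) (sym y+p≡x) ⟩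
  tri (y + q) + tri (y + p) + p * q        ≡⟨ tri-split y p q ⟩
  tri (y + p + q) + tri y                  ≡⟨ cong (λ l → tri l + tri y) (trans (cong (_+ q) y+p≡x) (m+[n∸m]≡n x≤L)) ⟩
  tri L + tri y                            ∎
  where
  open ≤-Reasoning
  y p q : ℕ
  y = a + x ∸ L
  p = L ∸ a
  q = L ∸ x
  L+y≡a+x : L + y ≡ a + x
  L+y≡a+x = m+[n∸m]≡n L≤a+x
  y+q≡a : y + q ≡ a
  y+q≡a = +-cancelʳ-≡ x _ _
    (trans (+-assoc y q x) (trans (cong (y +_) (m∸n+n≡m x≤L)) (trans (+-comm y L) L+y≡a+x)))
  y+p≡x : y + p ≡ x
  y+p≡x = +-cancelʳ-≡ a _ _
    (trans (+-assoc y p a) (trans (cong (y +_) (m∸n+n≡m a≤L)) (trans (+-comm y L) (trans L+y≡a+x (+-comm a x)))))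

-- An upper bound, by convexity of T, for Σ T(a_i) over parts a_i ≤ L with Σ a_i = x.
triCapped : ℕ → ℕ → ℕ
triCapped L x = tri (x ⊓ L) + tri (x ∸ L)

triCapped-below : ∀ {L x} → x ≤ L → triCapped L x ≡ tri x
triCapped-below x≤L = trans (cong₂ (λ u v → tri u + tri v) (m≤n⇒m⊓n≡m x≤L) (m≤n⇒m∸n≡0 x≤L)) (+-identityʳ _)

triCapped-above : ∀ {L x} → L ≤ x → triCapped L x ≡ tri L + tri (x ∸ L)
triCapped-above {L} {x} L≤x = cong (λ u → tri u + tri (x ∸ L)) (m≥n⇒m⊓n≡n L≤x)

triCapped-∷ : ∀ L a x → a ≤ L → tri a + triCapped L x ≤ triCapped L (a + x)
triCapped-∷ L a x a≤L with x ≤? L | a + x ≤? L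
... | yes x≤L | yes a+x≤L = begin
  tri a + triCapped L x     ≡⟨ cong (tri a +_) (triCapped-below x≤L) ⟩
  tri a + tri x             ≤⟨ tri-superadditive a x ⟩
  tri (a + x)               ≡⟨ triCapped-below a+x≤L ⟨
  triCapped L (a + x)       ∎
  where open ≤-Reasoning
... | yes x≤L | no a+x≰L = begin
  tri a + triCapped L x     ≡⟨ cong (tri a +_) (triCapped-below x≤L) ⟩
  tri a + tri x             ≤⟨ tri-exchange a≤L x≤L (<⇒≤ (≰⇒> a+x≰L)) ⟩
  tri L + tri (a + x ∸ L)   ≡⟨ triCapped-above (<⇒≤ (≰⇒> a+x≰L)) ⟨
  triCapped L (a + x)       ∎
  where open ≤-Reasoning
... | no x≰L | _ = begin
  tri a + triCapped L x         ≡⟨ cong (tri a +_) (triCapped-above L≤x) ⟩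
  tri a + (tri L + tri (x ∸ L)) ≡⟨ x∙yz≈y∙xz (tri a) (tri L) _ ⟩
  tri L + (tri a + tri (x ∸ L)) ≤⟨ +-monoʳ-≤ (tri L) (tri-superadditive a (x ∸ L)) ⟩
  tri L + tri (a + (x ∸ L))     ≡⟨ cong (λ z → tri L + tri z) (+-∸-assoc a L≤x) ⟨
  tri L + tri (a + x ∸ L)       ≡⟨ triCapped-above (≤-trans L≤x (m≤n+m x a)) ⟨
  triCapped L (a + x)           ∎
  where
  open ≤-Reasoning
  L≤x = <⇒≤ (≰⇒> x≰L)

triCapped-mono : ∀ {L} → 1 ≤ L → ∀ {x y} → x ≤ y → triCapped L x ≤ triCapped L y
triCapped-mono 1≤L {y = zero} z≤n = ≤-refl
triCapped-mono {L} 1≤L {x} {suc y} x≤1+y with m≤n⇒m<n∨m≡n x≤1+y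
... | inj₂ refl      = ≤-refl
... | inj₁ (s≤s x≤y) = ≤-trans (triCapped-mono 1≤L x≤y) (≤-trans (n≤1+n _) (triCapped-∷ L 1 y 1≤L))

sum-tri≤triCapped : ∀ L {as} → All (_≤ L) as → sum (map tri as) ≤ triCapped L (sum as)
sum-tri≤triCapped L []                        = z≤n
sum-tri≤triCapped L {a ∷ as} (a≤L ∷ as≤L) =
  ≤-trans (+-monoʳ-≤ (tri a) (sum-tri≤triCapped L as≤L)) (triCapped-∷ L a (sum as) a≤L)

tri-large-part : ∀ {L as} → Any (L <_) as → tri (suc L) ≤ sum (map tri as)
tri-large-part {as = a ∷ _} (here L<a)    = ≤-trans (tri-mono L<a) (m≤m+n (tri a) _)
tri-large-part {as = a ∷ _} (there large) = ≤-trans (tri-large-part large) (m≤n+m _ (tri a))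

not-sumOfTriangles : ∀ L s → tri s < L → ¬ SumOfTriangles (L + s) (tri L + L)
not-sumOfTriangles L s tri-s<L (as , budget , total) with All.all? (_≤? L) as
... | yes small = <-irrefl total (begin-strict
  sum (map tri as)          ≤⟨ sum-tri≤triCapped L small ⟩
  triCapped L (sum as)      ≤⟨ triCapped-mono (≤-trans (s≤s z≤n) tri-s<L) budget ⟩
  triCapped L (L + s)       ≡⟨ triCapped-above (m≤m+n L s) ⟩
  tri L + tri (L + s ∸ L)   ≡⟨ cong (λ z → tri L + tri z) (m+n∸m≡n L s) ⟩
  tri L + tri s             <⟨ +-monoʳ-< (tri L) tri-s<L ⟩
  tri L + L                 ∎)
  where open ≤-Reasoning
... | no ¬small = <-irrefl (sym total) (begin-strict
  tri L + L                 <⟨ ≤-reflexive (cong suc (+-comm (tri L) L)) ⟩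
  tri (suc L)               ≤⟨ tri-large-part (Any.map ≰⇒> (¬All⇒Any¬ (_≤? L) as ¬small)) ⟩
  sum (map tri as)          ∎)
  where open ≤-Reasoning

FirstTriangle : ℕ → ℕ → Set
FirstTriangle b m = ∃ λ a → a < b × tri (suc a) ≤ m × SumOfTriangles (b ∸ suc a) (m ∸ tri (suc a))

firstTriangle⇒sumOfTriangles : ∀ {b m} → FirstTriangle b m → SumOfTriangles b m
firstTriangle⇒sumOfTriangles (a , a<b , tri≤m , rest) =
  subst₂ SumOfTriangles (m+[n∸m]≡n a<b) (m+[n∸m]≡n tri≤m) (sumOfTriangles-∷ (suc a) rest)

sumOfTriangles⇒firstTriangle : ∀ {b m} → SumOfTriangles b (suc m) → FirstTriangle b (suc m)
sumOfTriangles⇒firstTriangle ([] , _ , ())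
sumOfTriangles⇒firstTriangle (zero ∷ as , budget , total) = sumOfTriangles⇒firstTriangle (as , budget , total)
sumOfTriangles⇒firstTriangle {b} (suc a ∷ as , budget , total) =
  a , ≤-trans (s≤s (m≤m+n a (sum as))) budget , ≤-trans (m≤m+n _ _) (≤-reflexive total) ,
  as , m+n≤o⇒m≤o∸n (sum as) (subst (_≤ b) (+-comm (suc a) (sum as)) budget) ,
  sym (trans (cong (_∸ tri (suc a)) (sym total)) (m+n∸m≡n (tri (suc a)) _))

sumOfTriangles? : ∀ b m → Dec (SumOfTriangles b m)
sumOfTriangles? b m = decide m b m ≤-refl
  where
  decide : ∀ fuel b m → m ≤ fuel → Dec (SumOfTriangles b m)
  decide _          b zero    _          = yes ([] , z≤n , refl)
  decide (suc fuel) b (suc m) (s≤s m≤fuel) =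
    map′ firstTriangle⇒sumOfTriangles sumOfTriangles⇒firstTriangle
      (anyUpTo? (λ a → (tri (suc a) ≤? suc m) ×-dec decide fuel (b ∸ suc a) (suc m ∸ tri (suc a)) (rest≤ a)) b)
    where
    rest≤ : ∀ a → suc m ∸ tri (suc a) ≤ fuel
    rest≤ a = ≤-trans (∸-monoʳ-≤ (suc m) (s≤s (z≤n {a + tri a}))) m≤fuel

least-failure : ∀ {P : ℕ → Set} → (∀ m → Dec (P m)) → ∀ B → ¬ P B →
                Σ ℕ λ M → M ≤ B × ¬ P M × (∀ m → m < M → P m)
least-failure {P} P? B ¬PB = search B (λ below → ¬PB (below (n<1+n B)))
  where
  search : ∀ B → ¬ (∀ {m} → m < suc B → P m) → Σ ℕ λ M → M ≤ B × ¬ P M × (∀ m → m < M → P m)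
  search zero ¬below = 0 , z≤n , (λ P0 → ¬below λ { (s≤s z≤n) → P0 }) , λ _ ()
  search (suc B) ¬below with allUpTo? P? (suc B)
  ... | yes below = suc B , ≤-refl , (λ PB → ¬below (λ m<2+B → [ below , (λ { refl → PB }) ] (m≤n⇒m<n∨m≡n (≤-pred m<2+B)))) ,
                    λ _ → below
  ... | no ¬below′ with M , M≤B , ¬PM , minimal ← search B ¬below′ = M , m≤n⇒m≤1+n M≤B , ¬PM , minimal

-- The smallest missing value

≤-slack : ∀ a c {b} → a + c ≡ b → a ≤ b
≤-slack a c eq = ≤-trans (m≤m+n a c) (≤-reflexive eq)

cube : ∀ n → n ^ 3 ≡ n * (n * n)
cube n = cong (λ m → n * (n * m)) (*-identityʳ n)

2*[tri+id] : ∀ k → 2 * (tri k + k) ≡ k * suc k + 2 * k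
2*[tri+id] k = trans (*-distribˡ-+ 2 (tri k) k) (cong (_+ 2 * k) (2*tri k))

Ns+2M≤N² : ∀ L s′ {M} → M ≤ tri L + L →
           let s = suc s′ ; N = suc (L + s) in N * s + 2 * M ≤ N * N
Ns+2M≤N² L s′ {M} M≤ = begin
  N * s + 2 * M               ≤⟨ +-monoʳ-≤ (N * s) (*-monoʳ-≤ 2 M≤) ⟩
  N * s + 2 * (tri L + L)     ≡⟨ cong (N * s +_) (2*[tri+id] L) ⟩
  N * s + (L * suc L + 2 * L) ≤⟨ ≤-slack _ (s′ * L + suc s) (ring L s′) ⟩
  N * N                       ∎
  where
  open ≤-Reasoning
  s N : ℕ
  s = suc s′
  N = suc (L + s)
  ring : ∀ L s′ → suc (L + suc s′) * suc s′ + (L * suc L + 2 * L) + (s′ * L + suc (suc s′)) ≡ suc (L + suc s′) * suc (L + suc s′)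
  ring = solve-∀

N²≤2M+8sN : ∀ A s {M} → tri A + A < M →
            let N = suc (A + 2 * (2 * s)) in N * N ≤ 2 * M + 8 * s * N
N²≤2M+8sN A s {M} A<M = begin
  N * N                               ≤⟨ ≤-slack _ (A + 16 * s * s + 1) (ring A s) ⟩
  2 + (A * suc A + 2 * A) + 8 * s * N ≡⟨ cong (_+ 8 * s * N) (trans (*-suc 2 (tri A + A)) (cong (2 +_) (2*[tri+id] A))) ⟨
  2 * suc (tri A + A) + 8 * s * N     ≤⟨ +-monoˡ-≤ (8 * s * N) (*-monoʳ-≤ 2 A<M) ⟩
  2 * M + 8 * s * N                   ∎
  where
  open ≤-Reasoning
  N : ℕ
  N = suc (A + 2 * (2 * s))
  ring : ∀ A s → suc (A + 2 * (2 * s)) * suc (A + 2 * (2 * s)) + (A + 16 * s * s + 1) ≡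
                 2 + (A * suc A + 2 * A) + 8 * s * suc (A + 2 * (2 * s))
  ring = solve-∀

gap-estimates : ∀ N s M → s * s ≤ N → N ≤ 4 * (s * s) → N * s + 2 * M ≤ N * N → N * N ≤ 2 * M + 8 * s * N →
                let K = N * N ∸ 2 * M in K + 2 * M ≡ N ^ 2 × N ^ 3 ≤ 4 * (K * K) × K * K ≤ 64 * N ^ 3
gap-estimates N s M s²≤N N≤4s² upper lower =
  trans (m∸n+n≡m (m+n≤o⇒n≤o (N * s) upper)) (cong (N *_) (sym (*-identityʳ N))) ,
  (begin
    N ^ 3                  ≡⟨ cube N ⟩
    N * (N * N)            ≤⟨ *-monoʳ-≤ N (*-monoʳ-≤ N N≤4s²) ⟩
    N * (N * (4 * (s * s))) ≡⟨ ring₁ N s ⟩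
    4 * ((N * s) * (N * s)) ≤⟨ *-monoʳ-≤ 4 (*-mono-≤ Ns≤K Ns≤K) ⟩
    4 * (K * K)            ∎) ,
  (begin
    K * K                  ≤⟨ *-mono-≤ K≤8sN K≤8sN ⟩
    8 * s * N * (8 * s * N) ≡⟨ ring₂ N s ⟩
    64 * (N * (N * (s * s))) ≤⟨ *-monoʳ-≤ 64 (*-monoʳ-≤ N (*-monoʳ-≤ N s²≤N)) ⟩
    64 * (N * (N * N))     ≡⟨ cong (64 *_) (cube N) ⟨
    64 * N ^ 3             ∎)
  where
  open ≤-Reasoning
  K : ℕ
  K = N * N ∸ 2 * M
  Ns≤K : N * s ≤ K
  Ns≤K = m+n≤o⇒m≤o∸n (N * s) upper
  K≤8sN : K ≤ 8 * s * N
  K≤8sN = m≤n+o⇒m∸n≤o (N * N) (2 * M) lower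
  ring₁ : ∀ N s → N * (N * (4 * (s * s))) ≡ 4 * ((N * s) * (N * s))
  ring₁ = solve-∀
  ring₂ : ∀ N s → 8 * s * N * (8 * s * N) ≡ 64 * (N * (N * (s * s)))
  ring₂ = solve-∀

fraction-normalise : ∀ a d → ℚ.toℚᵘ (pos a ℚ./ suc d) ℚᵘ.≃ ℚᵘ.mkℚᵘ (pos a) d
fraction-normalise a d = ℚ.toℚᵘ-fromℚᵘ (ℚᵘ.mkℚᵘ (pos a) d)

fraction-≡ : ∀ (p : ℚ) a d → ℚ.toℚᵘ p ℚᵘ.≃ ℚᵘ.mkℚᵘ (pos a) d → p ≡ (pos a) ℚ./ suc d
fraction-≡ p a d p≃ = ℚ.toℚᵘ-injective (ℚᵘ.≃-trans p≃ (ℚᵘ.≃-sym (fraction-normalise a d)))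

fraction-≤ : ∀ a b d e → a * suc e ≤ b * suc d → (pos a) ℚ./ suc d ≤ℚ (pos b) ℚ./ suc e
fraction-≤ a b d e ≤ = ℚ.toℚᵘ-cancel-≤
  (ℚᵘ.≤-respˡ-≃ (ℚᵘ.≃-sym (fraction-normalise a d)) (ℚᵘ.≤-respʳ-≃ (ℚᵘ.≃-sym (fraction-normalise b e))
    (ℚᵘ.*≤* (ℤ.≤-trans (ℤ.≤-reflexive (sym (ℤ.pos-* a (suc e)))) (ℤ.≤-trans (+≤+ ≤) (ℤ.≤-reflexive (ℤ.pos-* b (suc d))))))))

fraction-* : ∀ a d b e → (pos a ℚ./ suc d) ℚ.* (pos b ℚ./ suc e) ≡ (pos (a * b)) ℚ./ suc (e + d * suc e)
fraction-* a d b e = fraction-≡ _ (a * b) (e + d * suc e)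
  (ℚᵘ.≃-trans (ℚ.toℚᵘ-homo-* (pos a ℚ./ suc d) (pos b ℚ./ suc e))
    (ℚᵘ.≃-trans (ℚᵘ.*-cong (fraction-normalise a d) (fraction-normalise b e))
      (ℚᵘ.*≡* (cong (_*ℤ pos (suc (e + d * suc e))) (sym (ℤ.pos-* a b))))))

half-minus : ∀ k m → ((pos (k + 2 * m)) ℚ./ 2) ℚ.- (pos m ℚ./ 1) ≡ pos k ℚ./ 2
half-minus k m = fraction-≡ _ k 1
  (ℚᵘ.≃-trans (ℚ.toℚᵘ-homo-+ ((pos (k + 2 * m)) ℚ./ 2) (ℚ.- (pos m ℚ./ 1)))
    (ℚᵘ.≃-trans (ℚᵘ.+-cong (fraction-normalise (k + 2 * m) 1)
                            (ℚᵘ.≃-trans (ℚ.toℚᵘ-homo‿- (pos m ℚ./ 1)) (ℚᵘ.-‿cong (fraction-normalise m 0))))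
      (ℚᵘ.*≡* (trans (cong (λ x → (x *ℤ pos 1 +ℤ (-ℤ (pos m)) *ℤ pos 2) *ℤ pos 2)
                           (trans (ℤ.pos-+ k (2 * m)) (cong (pos k +ℤ_) (ℤ.pos-* 2 m))))
                     (ring (pos k) (pos m))))))
  where
  ring : ∀ k m → ((k +ℤ pos 2 *ℤ m) *ℤ pos 1 +ℤ (-ℤ m) *ℤ pos 2) *ℤ pos 2 ≡ k *ℤ pos 2
  ring = ℤ-Solver.solve-∀

upperConstant : ℚ
upperConstant = pos 4 ℚ./ 1

lowerConstant : ℚ
lowerConstant = pos 1 ℚ./ 4

0<lowerConstant : 0ℚ <ℚ lowerConstant
0<lowerConstant = ℚ.*<* (+<+ (s≤s z≤n))

lowerConstant≤upperConstant : lowerConstant ≤ℚ upperConstant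
lowerConstant≤upperConstant = fraction-≤ 1 4 3 0 (s≤s z≤n)

gap-bounds : ∀ N M K → K + 2 * M ≡ N ^ 2 → N ^ 3 ≤ 4 * (K * K) → K * K ≤ 64 * N ^ 3 →
             ≤cN√N (gap N M) upperConstant N × cN√N≤ lowerConstant N (gap N M)
gap-bounds N M K K+2M≡N² N³≤ K²≤ =
  inj₂ (subst₂ _≤ℚ_ (sym gap²) (sym upper²N³) (fraction-≤ (K * K) (4 * 4 * N ^ 3) 3 0 K²≤′)) ,
  subst (toℚ 0 ≤ℚ_) (sym gap≡) (fraction-≤ 0 K 0 1 z≤n) ,
  subst₂ _≤ℚ_ (sym lower²N³) (sym gap²) (fraction-≤ (1 * N ^ 3) (K * K) 15 3 N³≤′)
  where
  gap≡ : gap N M ≡ (pos K) ℚ./ 2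
  gap≡ = trans (cong (λ x → ((pos x) ℚ./ 2) ℚ.- toℚ M) (sym K+2M≡N²)) (half-minus K M)
  N³≤′ : 1 * N ^ 3 * 4 ≤ K * K * 16
  N³≤′ = ≤-trans (≤-reflexive (cong (_* 4) (*-identityˡ (N ^ 3)))) (≤-trans (*-monoˡ-≤ 4 N³≤) (≤-reflexive (ring₁ (K * K))))
    where
    ring₁ : ∀ y → 4 * y * 4 ≡ y * 16
    ring₁ = solve-∀
  K²≤′ : K * K * 1 ≤ 4 * 4 * N ^ 3 * 4
  K²≤′ = ≤-trans (≤-reflexive (*-identityʳ (K * K))) (≤-trans K²≤ (≤-reflexive (ring₂ (N ^ 3))))
    where
    ring₂ : ∀ x → 64 * x ≡ 4 * 4 * x * 4
    ring₂ = solve-∀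
  gap² : gap N M ℚ.* gap N M ≡ (pos (K * K)) ℚ./ 4
  gap² = trans (cong₂ ℚ._*_ gap≡ gap≡) (fraction-* K 1 K 1)
  lower²N³ : lowerConstant ℚ.* lowerConstant ℚ.* toℚ (N ^ 3) ≡ (pos (1 * N ^ 3)) ℚ./ 16
  lower²N³ = trans (cong (ℚ._* toℚ (N ^ 3)) (fraction-* 1 3 1 3)) (fraction-* 1 15 (N ^ 3) 0)
  upper²N³ : upperConstant ℚ.* upperConstant ℚ.* toℚ (N ^ 3) ≡ (pos (4 * 4 * N ^ 3)) ℚ./ 1
  upper²N³ = trans (cong (ℚ._* toℚ (N ^ 3)) (fraction-* 4 0 4 0)) (fraction-* (4 * 4) 0 (N ^ 3) 0)

BoundedSmallestMissing : ℕ → Set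
BoundedSmallestMissing N =
  Σ ℕ λ M → SmallestMissing N M × ≤cN√N (gap N M) upperConstant N × cN√N≤ lowerConstant N (gap N M)

-- N = s² + r with s = 5 + t and r ≤ 2s; A = N − 1 − 4s and L = N − 1 − s are written as
-- polynomials in t and r so that the ring solver applies and no truncated subtraction occurs.
module NearSquare (t r : ℕ) (r≤2s : r ≤ 2 * (5 + t)) where

  s N A L : ℕ
  s = 5 + t
  N = s * s + r
  A = 4 + 6 * t + t * t + r
  L = 19 + 9 * t + t * t + r

  N≡1+A+4s : N ≡ suc (A + 2 * (2 * s))
  N≡1+A+4s = ring t r
    where
    ring : ∀ t r → (5 + t) * (5 + t) + r ≡ suc (4 + 6 * t + t * t + r + 2 * (2 * (5 + t)))
    ring = solve-∀

  N≡1+L+s : N ≡ suc (L + s)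
  N≡1+L+s = ring t r
    where
    ring : ∀ t r → (5 + t) * (5 + t) + r ≡ suc (19 + 9 * t + t * t + r + (5 + t))
    ring = solve-∀

  A≤ : A ≤ tri (2 * s) + 2 * s
  A≤ = *-cancelˡ-≤ 2 (begin
    2 * A                                      ≤⟨ *-monoʳ-≤ 2 (+-monoʳ-≤ (4 + 6 * t + t * t) r≤2s) ⟩
    2 * (4 + 6 * t + t * t + 2 * s)            ≤⟨ ≤-slack _ (102 + 30 * t + 2 * (t * t)) (ring t) ⟩
    2 * s * suc (2 * s) + 2 * (2 * s)          ≡⟨ cong (_+ 2 * (2 * s)) (2*tri (2 * s)) ⟨
    2 * tri (2 * s) + 2 * (2 * s)              ≡⟨ *-distribˡ-+ 2 (tri (2 * s)) (2 * s) ⟨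
    2 * (tri (2 * s) + 2 * s)                  ∎)
    where
    open ≤-Reasoning
    ring : ∀ t → 2 * (4 + 6 * t + t * t + 2 * (5 + t)) + (102 + 30 * t + 2 * (t * t)) ≡ 2 * (5 + t) * suc (2 * (5 + t)) + 2 * (2 * (5 + t))
    ring = solve-∀

  tri-s<L : tri s < L
  tri-s<L = *-cancelˡ-≤ 2 (begin
    2 * suc (tri s)                            ≡⟨ trans (*-suc 2 (tri s)) (cong (2 +_) (2*tri s)) ⟩
    2 + s * suc s                              ≤⟨ ≤-slack _ (6 + 7 * t + t * t + 2 * r) (ring t r) ⟩
    2 * L                                      ∎)
    where
    open ≤-Reasoning
    ring : ∀ t r → 2 + (5 + t) * suc (5 + t) + (6 + 7 * t + t * t + 2 * r) ≡ 2 * (19 + 9 * t + t * t + r)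
    ring = solve-∀

  representable : ∀ m → m ≤ tri A + A → SumOfTriangles (N ∸ 1) m
  representable m m≤ = subst (λ b → SumOfTriangles b m) (cong (_∸ 1) (sym N≡1+A+4s)) (sumOfTriangles-upTo A (2 * s) A≤ m≤)

  M⋆ : ℕ
  M⋆ = tri L + L

  M⋆-missing : ¬ SumOfTriangles (N ∸ 1) M⋆
  M⋆-missing = subst (λ b → ¬ SumOfTriangles b M⋆) (cong (_∸ 1) (sym N≡1+L+s)) (not-sumOfTriangles L s tri-s<L)

  M⋆≤N-C-2 : M⋆ ≤ N C 2
  M⋆≤N-C-2 = begin
    tri L + L                  ≤⟨ n≤1+n _ ⟩
    suc (tri L + L)            ≡⟨ cong suc (+-comm (tri L) L) ⟩
    tri (suc L)                ≤⟨ tri-mono (≤-trans (s≤s (m≤m+n L (4 + t))) (≤-reflexive (sym (+-suc L (4 + t))))) ⟩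
    tri (L + s)                ≡⟨ cong (λ n → tri (n ∸ 1)) N≡1+L+s ⟨
    tri (N ∸ 1)                ≡⟨ C2≡tri N ⟨
    N C 2                      ∎
    where open ≤-Reasoning

  s²≤N : s * s ≤ N
  s²≤N = m≤m+n (s * s) r

  N≤4s² : N ≤ 4 * (s * s)
  N≤4s² = ≤-trans (+-monoʳ-≤ (s * s) r≤2s) (≤-slack _ (65 + 28 * t + 3 * (t * t)) (ring t))
    where
    ring : ∀ t → (5 + t) * (5 + t) + 2 * (5 + t) + (65 + 28 * t + 3 * (t * t)) ≡ 4 * ((5 + t) * (5 + t))
    ring = solve-∀

  upper : ∀ {M} → M ≤ M⋆ → N * s + 2 * M ≤ N * N
  upper {M} M≤M⋆ = subst (λ n → n * s + 2 * M ≤ n * n) (sym N≡1+L+s) (Ns+2M≤N² L (4 + t) M≤M⋆)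

  lower : ∀ {M} → tri A + A < M → N * N ≤ 2 * M + 8 * s * N
  lower {M} A<M = subst (λ n → n * n ≤ 2 * M + 8 * s * n) (sym N≡1+A+4s) (N²≤2M+8sN A s A<M)

  1≤N : 1 ≤ N
  1≤N = subst (1 ≤_) (sym N≡1+L+s) (s≤s z≤n)

  smallest-missing : ∀ {M} → M ≤ M⋆ → ¬ SumOfTriangles (N ∸ 1) M → (∀ m → m < M → SumOfTriangles (N ∸ 1) m) →
                     SmallestMissing N M
  smallest-missing M≤M⋆ ¬M below =
    ≤-trans M≤M⋆ M⋆≤N-C-2 , ¬M ∘ realizable⇒sumOfTriangles , λ m m<M → sumOfTriangles⇒realizable 1≤N (below m m<M)

  gap-of-smallest-missing : ∀ {M} → M ≤ M⋆ → ¬ SumOfTriangles (N ∸ 1) M →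
                            ≤cN√N (gap N M) upperConstant N × cN√N≤ lowerConstant N (gap N M)
  gap-of-smallest-missing {M} M≤M⋆ ¬M =
    let A<M = ≰⇒> λ M≤ → ¬M (representable M M≤)
        K+2M≡N² , N³≤4K² , K²≤64N³ = gap-estimates N s M s²≤N N≤4s² (upper M≤M⋆) (lower A<M)
    in  gap-bounds N M (N * N ∸ 2 * M) K+2M≡N² N³≤4K² K²≤64N³

  bounded-smallest-missing : BoundedSmallestMissing N
  bounded-smallest-missing =
    let M , M≤M⋆ , ¬M , below = least-failure (sumOfTriangles? (N ∸ 1)) M⋆ M⋆-missing
    in  M , smallest-missing M≤M⋆ ¬M below , gap-of-smallest-missing M≤M⋆ ¬M

isqrt : ∀ N → ∃ λ s → s * s ≤ N × N < suc s * suc s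
isqrt N with least-failure (λ k → k * k ≤? N) (suc N) (<⇒≱ (s≤s (m≤m+n N (N * suc N))))
... | zero  , _ , ¬0² , _     = ⊥-elim (¬0² z≤n)
... | suc s , _ , ¬M² , below = s , below s (n<1+n s) , ≰⇒> ¬M²

25≤N⇒boundedSmallestMissing : ∀ N → 25 ≤ N → BoundedSmallestMissing N
25≤N⇒boundedSmallestMissing N 25≤N with s , s²≤N , N<[1+s]² ← isqrt N =
  subst BoundedSmallestMissing N≡ (NearSquare.bounded-smallest-missing t (N ∸ s * s) r≤2s)
  where
  5≤s : 5 ≤ s
  5≤s = ≮⇒≥ λ s<5 → <⇒≱ N<[1+s]² (≤-trans (*-mono-≤ s<5 s<5) 25≤N)
  t : ℕ
  t = s ∸ 5
  5+t≡s : 5 + t ≡ s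
  5+t≡s = m+[n∸m]≡n 5≤s
  r≤2s : N ∸ s * s ≤ 2 * (5 + t)
  r≤2s = m≤n+o⇒m∸n≤o N (s * s)
           (subst (λ x → N ≤ s * s + 2 * x) (sym 5+t≡s) (≤-pred (≤-trans N<[1+s]² (≤-reflexive (ring s)))))
    where
    ring : ∀ s → suc s * suc s ≡ suc (s * s + 2 * s)
    ring = solve-∀
  N≡ : NearSquare.N t (N ∸ s * s) r≤2s ≡ N
  N≡ = trans (cong (λ x → x * x + (N ∸ s * s)) 5+t≡s) (m+[n∸m]≡n s²≤N)

mainTheorem3 : Σ ℚ λ c₀ → Σ ℚ λ c₁ → (0ℚ <ℚ c₁) × (c₁ ≤ℚ c₀) × Σ ℕ λ N₀ → (N : ℕ) → N₀ ≤ N → Σ ℕ λ M → SmallestMissing N M × ≤cN√N (gap N M) c₀ N × cN√N≤ c₁ N (gap N M)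
mainTheorem3 =
  upperConstant , lowerConstant , 0<lowerConstant , lowerConstant≤upperConstant , 25 , 25≤N⇒boundedSmallestMissing
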